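{- For every integer $k\ge 2$ there exists $n_0=n_0(k)$ such that for all $n\ge n_0$, \[ F(n,k)\le f(n,k)\le k\cdot 2^{\,n/2+2\log n\,\sqrt{n}}. \]
   Context: $B_n$ denotes the Boolean lattice, i.e. the power set $2^{[n]}$ of $[n]=\{1,\dots,n\}$ ordered by inclusion. An antichain of size $k$ is a family of $k$ pairwise incomparable sets. For a (partial) coloring $c$ of $B_n$, a family is rainbow if its members receive pairwise distinct colors (in a partial coloring, all members must be colored). $F(n,k)$ is the maximum $m$ such that there is a coloring $c:B_n\to[k]$ of all of $B_n$ with no rainbow antichain of size $k$ and with every color class $c^{ -1}(\{i\})$, $i\in[k]$, of size at least $m$. $f(n,k)$ is defined identically except that $c$ may be a partial coloring (some sets left uncolored). Here $\log$ denotes the logarithm to base $2$. -}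

module Defs where

open import Data.Nat using (ℕ; zero; suc; _+_; _*_; _^_; _≤_; _<_)
open import Data.Fin using (Fin)
open import Data.Fin.Subset using (Subset; _⊆_; inside; outside)
open import Data.Vec using (_∷_; [])
open import Data.List using (List; _++_; map; filter; length)
import Data.List as L
open import Data.Maybe using (Maybe; just)
open import Data.Maybe.Properties using (≡-dec)
import Data.Fin.Properties as FinP
open import Data.Product using (Σ; _×_)
open import Relation.Nullary using (¬_)
open import Relation.Binary.PropositionalEquality using (_≡_; _≢_)

-- B_n : subsets of [n], represented as characteristic vectors (Subset n = Vec Bool n),
-- ordered by inclusion _⊆_.

allSubsets : (n : ℕ) → List (Subset n)
allSubsets zero    = [] L.∷ L.[]
allSubsets (suc n) = map (outside ∷_) (allSubsets n) ++ map (inside ∷_) (allSubsets n)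

-- a partial coloring of B_n with colors in [k] (= Fin k); nothing = uncolored
PartialColoring : ℕ → ℕ → Set
PartialColoring n k = Subset n → Maybe (Fin k)

Coloring : ℕ → ℕ → Set
Coloring n k = Subset n → Fin k

total : ∀ {n k} → Coloring n k → PartialColoring n k
total c S = just (c S)

classSize : ∀ {n k} → PartialColoring n k → Fin k → ℕ
classSize {n} c i = length (filter (λ S → ≡-dec FinP._≟_ (c S) (just i)) (allSubsets n))

IsAntichain : ∀ {n s} → (Fin s → Subset n) → Set
IsAntichain A = ∀ i j → i ≢ j → ¬ (A i ⊆ A j)

IsRainbow : ∀ {n k s} → PartialColoring n k → (Fin s → Subset n) → Set
IsRainbow {k = k} {s = s} c A =
  Σ (Fin s → Fin k) λ col → (∀ i → c (A i) ≡ just (col i)) × (∀ i j → i ≢ j → col i ≢ col j)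

NoRainbowAntichain : ∀ {n k} → PartialColoring n k → Set
NoRainbowAntichain {n} {k} c = (A : Fin k → Subset n) → IsAntichain A → ¬ IsRainbow c A

AchievablePartial : ℕ → ℕ → ℕ → Set
AchievablePartial n k m =
  Σ (PartialColoring n k) λ c → NoRainbowAntichain c × (∀ i → m ≤ classSize c i)

AchievableTotal : ℕ → ℕ → ℕ → Set
AchievableTotal n k m =
  Σ (Coloring n k) λ c → NoRainbowAntichain (total c) × (∀ i → m ≤ classSize (total c) i)

IsMax : (ℕ → Set) → ℕ → Set
IsMax P x = P x × (∀ y → P y → y ≤ x)

IsF : ℕ → ℕ → ℕ → Set
IsF n k F = IsMax (AchievableTotal n k) F

Isf : ℕ → ℕ → ℕ → Set
Isf n k f = IsMax (AchievablePartial n k) f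

-- m ≤ k · 2^(n/2 + 2 log₂ n · √n)   (real exponent), encoded over ℕ.
-- Since 2^(2 log₂ n √n) = n^(2√n), this is m² ≤ k² 2ⁿ n^(4√n), i.e.
-- A := m²/(k² 2ⁿ) ≤ n^(4√n).  For n ≥ 1 this is equivalent to:
-- for every rational p/q (q > 0) with p/q > 4√n (i.e. p² > 16 n q²),  A^q < n^p,
-- i.e.  (m²)^q < n^p · (k² · 2ⁿ)^q.
BoundedBy : ℕ → ℕ → ℕ → Set
BoundedBy n k m =
  ∀ p q → 0 < q → 16 * n * (q ^ 2) < p ^ 2 →
    (m ^ 2) ^ q < n ^ p * ((k ^ 2) * 2 ^ n) ^ q

{-# OPTIONS --safe #-}
module Submission where

-- Let c colour B_n with k colours and no rainbow k-antichain.  For a set x of colour 0, the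
-- sets incomparable to x, coloured by the other k - 1 colours, contain no rainbow
-- (k - 1)-antichain (adding x would give a rainbow k-antichain for c), so by induction on k
-- some colour i has few members incomparable to x.  Colour 0 is thus covered by k - 1
-- families X_i, each member of X_i being incomparable to few sets of colour i.  If all
-- members of X_i have size at most n/2, let U be their union, spanned by at most n witnesses
-- w_e ∋ e.  Either |U| ≤ n/2 and X_i ⊆ 2^U is small, or every set of colour i is
-- incomparable to some w_e, lies below some w_e, or contains U, and all three kinds are few.
-- Families of large sets are handled by complementation.  Hence some colour class has at
-- most (3 + 2n)^(k-1) 2^⌊n/2⌋ members: a polynomial factor times 2^(n/2).

open import Defs
open import Level using (0ℓ)
open import Function using (_∘_; id)
open import Algebra.Properties.CommutativeSemigroup using (interchange)
open import Data.Nat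
  using (ℕ; zero; suc; _+_; _*_; _∸_; _^_; _≤_; _<_; z≤n; s≤s; _≤?_; ⌊_/2⌋; NonZero; >-nonZero)
open import Data.Nat.Properties
open import Data.Nat.Tactic.RingSolver using (solve-∀)
open import Data.Bool using (true; false; if_then_else_)
open import Data.Empty using (⊥-elim)
open import Data.Fin using (Fin; zero; suc)
open import Data.Fin.Properties using (any?)
import Data.Fin.Properties as Finₚ
open import Data.Fin.Subset using (Subset; Side; inside; outside; _⊆_; _⊈_; _∈_; ∣_∣; ∁; ⊥)
open import Data.Fin.Subset.Properties
  using ( _⊆?_; _∈?_; anySubset?; drop-∷-⊆; out⊆; in⊆in; ⊥⊆; ∣⊥∣≡0; ∣p∣≤n; ∣∁p∣≡n∸∣p∣
        ; p⊆q⇒∁p⊇∁q; ∁p⊆∁q⇒p⊇q )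
open import Data.List using (List; _∷_; []; map; filter; length; _++_)
open import Data.List.Properties using (length-++; length-map; filter-++)
open import Data.Maybe using (just; nothing)
open import Data.Maybe.Properties using (≡-dec)
open import Data.Product using (Σ; ∃; _×_; _,_; proj₁; proj₂)
import Data.Product as Product
open import Data.Sum using (_⊎_; inj₁; inj₂)
import Data.Sum as Sum
open import Data.Vec using (_∷_; []; here; lookup; tabulate)
open import Data.Vec.Properties using (lookup∘tabulate; []=⇒lookup; lookup⇒[]=)
open import Data.Vec.Functional using () renaming (_∷_ to _◂_)
open import Relation.Binary.PropositionalEquality
open import Relation.Nullary using (Dec; yes; no; does; ¬_; ¬?; _×-dec_; contradiction)
open import Relation.Unary using (Pred; Decidable)
open import Relation.Unary.Properties using (_∩?_; _∪?_; ∁?)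

private
  variable
    n k m : ℕ
    P Q R : Pred (Subset n) 0ℓ

-- Counting decidable families of subsets

count : Decidable P → ℕ
count {zero}  P? = if does (P? []) then 1 else 0
count {suc n} P? = count (P? ∘ (outside ∷_)) + count (P? ∘ (inside ∷_))

filter-map : ∀ {A B : Set} {P : Pred B 0ℓ} (P? : Decidable P) (f : A → B) (xs : List A) →
             filter P? (map f xs) ≡ map f (filter (P? ∘ f) xs)
filter-map P? f []       = refl
filter-map P? f (x ∷ xs) with does (P? (f x))
... | true  = cong (f x ∷_) (filter-map P? f xs)
... | false = filter-map P? f xs

length-filter-allSubsets : (P? : Decidable P) → length (filter P? (allSubsets n)) ≡ count P?
length-filter-allSubsets {n = zero} P? with does (P? [])
... | true  = refl
... | false = refl
length-filter-allSubsets {n = suc n} P? = begin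
  length (filter P? (half outside ++ half inside))
    ≡⟨ cong length (filter-++ P? (half outside) (half inside)) ⟩
  length (filter P? (half outside) ++ filter P? (half inside))
    ≡⟨ length-++ (filter P? (half outside)) ⟩
  length (filter P? (half outside)) + length (filter P? (half inside))
    ≡⟨ cong₂ _+_ (length-filter-half outside) (length-filter-half inside) ⟩
  count (P? ∘ (outside ∷_)) + count (P? ∘ (inside ∷_)) ∎
  where
  open ≡-Reasoning
  half : Side → List (Subset (suc n))
  half s = map (s ∷_) (allSubsets n)
  length-filter-half : ∀ s → length (filter P? (half s)) ≡ count (P? ∘ (s ∷_))
  length-filter-half s = begin
    length (filter P? (map (s ∷_) (allSubsets n)))
      ≡⟨ cong length (filter-map P? (s ∷_) (allSubsets n)) ⟩
    length (map (s ∷_) (filter (P? ∘ (s ∷_)) (allSubsets n)))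
      ≡⟨ length-map (s ∷_) (filter (P? ∘ (s ∷_)) (allSubsets n)) ⟩
    length (filter (P? ∘ (s ∷_)) (allSubsets n))
      ≡⟨ length-filter-allSubsets (P? ∘ (s ∷_)) ⟩
    count (P? ∘ (s ∷_)) ∎

count-mono : (P? : Decidable P) (Q? : Decidable Q) → (∀ {s} → P s → Q s) → count P? ≤ count Q?
count-mono {zero} P? Q? P⇒Q with P? [] | Q? []
... | yes _ | yes _ = ≤-refl
... | yes p | no ¬q = contradiction (P⇒Q p) ¬q
... | no _  | _     = z≤n
count-mono {suc n} P? Q? P⇒Q =
  +-mono-≤ (count-mono (P? ∘ (outside ∷_)) (Q? ∘ (outside ∷_)) P⇒Q)
           (count-mono (P? ∘ (inside ∷_)) (Q? ∘ (inside ∷_)) P⇒Q)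

count-cong : (P? : Decidable P) (Q? : Decidable Q) →
             (∀ {s} → P s → Q s) → (∀ {s} → Q s → P s) → count P? ≡ count Q?
count-cong P? Q? P⇒Q Q⇒P = ≤-antisym (count-mono P? Q? P⇒Q) (count-mono Q? P? Q⇒P)

count-empty : (P? : Decidable P) → (∀ s → ¬ P s) → count P? ≡ 0
count-empty {zero} P? ¬P with P? []
... | yes p = contradiction p (¬P [])
... | no _  = refl
count-empty {suc n} P? ¬P =
  cong₂ _+_ (count-empty (P? ∘ (outside ∷_)) (¬P ∘ (outside ∷_)))
            (count-empty (P? ∘ (inside ∷_)) (¬P ∘ (inside ∷_)))

count-⊎ : (P? : Decidable P) (Q? : Decidable Q) (R? : Decidable R) →
          (∀ {s} → P s → Q s ⊎ R s) → count P? ≤ count Q? + count R?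
count-⊎ {zero} P? Q? R? cover with P? [] | Q? [] | R? []
... | no _  | _     | _     = z≤n
... | yes _ | yes _ | _     = s≤s z≤n
... | yes _ | no _  | yes _ = ≤-refl
... | yes p | no ¬q | no ¬r = Sum.[ (λ q → contradiction q ¬q) , (λ r → contradiction r ¬r) ]′ (cover p)
count-⊎ {suc n} P? Q? R? cover =
  ≤-trans (+-mono-≤ (count-⊎ (P? ∘ (outside ∷_)) (Q? ∘ (outside ∷_)) (R? ∘ (outside ∷_)) cover)
                    (count-⊎ (P? ∘ (inside ∷_)) (Q? ∘ (inside ∷_)) (R? ∘ (inside ∷_)) cover))
          (≤-reflexive (interchange +-commutativeSemigroup
            (count (Q? ∘ (outside ∷_))) (count (R? ∘ (outside ∷_)))
            (count (Q? ∘ (inside ∷_))) (count (R? ∘ (inside ∷_)))))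

count-∃ : {Q : Fin k → Pred (Subset n) 0ℓ} (P? : Decidable P) (Q? : ∀ i → Decidable (Q i)) {b : ℕ} →
          (∀ {s} → P s → ∃ λ i → Q i s) → (∀ i → count (Q? i) ≤ b) → count P? ≤ k * b
count-∃ {k = zero} P? Q? cover _ =
  ≤-reflexive (count-empty P? (λ s p → contradiction (proj₁ (cover {s} p)) λ ()))
count-∃ {k = suc k} {P = P} {Q = Q} P? Q? {b} cover bounded = begin
  count P?                       ≤⟨ count-⊎ P? (Q? zero) Rest? split ⟩
  count (Q? zero) + count Rest?  ≤⟨ +-mono-≤ (bounded zero) (count-∃ Rest? (Q? ∘ suc) id (bounded ∘ suc)) ⟩
  b + k * b                      ∎
  where
  open ≤-Reasoning
  Rest? : Decidable (λ s → ∃ λ i → Q (suc i) s)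
  Rest? s = any? (λ i → Q? (suc i) s)
  split : ∀ {s} → P s → Q zero s ⊎ ∃ λ i → Q (suc i) s
  split p with cover p
  ... | zero  , q = inj₁ q
  ... | suc i , q = inj₂ (i , q)

count-∘-∁ : (P? : Decidable P) → count (P? ∘ ∁) ≡ count P?
count-∘-∁ {zero}  P? = refl
count-∘-∁ {suc n} P? = begin
  count (P? ∘ ∁ ∘ (outside ∷_)) + count (P? ∘ ∁ ∘ (inside ∷_))
    ≡⟨ cong₂ _+_ (count-∘-∁ (P? ∘ (inside ∷_))) (count-∘-∁ (P? ∘ (outside ∷_))) ⟩
  count (P? ∘ (inside ∷_)) + count (P? ∘ (outside ∷_))
    ≡⟨ +-comm (count (P? ∘ (inside ∷_))) _ ⟩
  count (P? ∘ (outside ∷_)) + count (P? ∘ (inside ∷_)) ∎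
  where open ≡-Reasoning

count-⊆≡2^∣p∣ : ∀ (p : Subset n) → count (_⊆? p) ≡ 2 ^ ∣ p ∣
count-⊆≡2^∣p∣ []            = refl
count-⊆≡2^∣p∣ (outside ∷ p) = begin
  count (λ y → outside ∷ y ⊆? outside ∷ p) + count (λ y → inside ∷ y ⊆? outside ∷ p)
    ≡⟨ cong₂ _+_ (count-cong _ (_⊆? p) drop-∷-⊆ out⊆)
                 (count-empty (λ y → inside ∷ y ⊆? outside ∷ p) (λ y ⊆p → contradiction (⊆p here) λ ())) ⟩
  count (_⊆? p) + 0
    ≡⟨ +-identityʳ _ ⟩
  count (_⊆? p)
    ≡⟨ count-⊆≡2^∣p∣ p ⟩
  2 ^ ∣ p ∣ ∎
  where open ≡-Reasoning
count-⊆≡2^∣p∣ (inside ∷ p) = begin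
  count (λ y → outside ∷ y ⊆? inside ∷ p) + count (λ y → inside ∷ y ⊆? inside ∷ p)
    ≡⟨ cong₂ _+_ (count-cong _ (_⊆? p) drop-∷-⊆ out⊆) (count-cong _ (_⊆? p) drop-∷-⊆ in⊆in) ⟩
  count (_⊆? p) + count (_⊆? p)
    ≡⟨ cong (λ c → c + c) (count-⊆≡2^∣p∣ p) ⟩
  2 ^ ∣ p ∣ + 2 ^ ∣ p ∣
    ≡⟨ cong (2 ^ ∣ p ∣ +_) (+-identityʳ _) ⟨
  2 ^ suc ∣ p ∣ ∎
  where open ≡-Reasoning

count-⊇≡2^∣∁p∣ : ∀ (p : Subset n) → count (p ⊆?_) ≡ 2 ^ ∣ ∁ p ∣
count-⊇≡2^∣∁p∣ p = begin
  count (p ⊆?_)          ≡⟨ count-cong (p ⊆?_) ((_⊆? ∁ p) ∘ ∁) p⊆q⇒∁p⊇∁q ∁p⊆∁q⇒p⊇q ⟩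
  count ((_⊆? ∁ p) ∘ ∁)  ≡⟨ count-∘-∁ (_⊆? ∁ p) ⟩
  count (_⊆? ∁ p)        ≡⟨ count-⊆≡2^∣p∣ (∁ p) ⟩
  2 ^ ∣ ∁ p ∣            ∎
  where open ≡-Reasoning

Incomparable : Subset n → Subset n → Set
Incomparable x y = x ⊈ y × y ⊈ x

incomparable? : ∀ (x y : Subset n) → Dec (Incomparable x y)
incomparable? x y = ¬? (x ⊆? y) ×-dec ¬? (y ⊆? x)

∁-incomparable : ∀ {x y : Subset n} → Incomparable x y → Incomparable (∁ x) (∁ y)
∁-incomparable (x⊈y , y⊈x) = y⊈x ∘ ∁p⊆∁q⇒p⊇q , x⊈y ∘ ∁p⊆∁q⇒p⊇q

⊥-comparable : ∀ (y : Subset n) → ¬ Incomparable ⊥ y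
⊥-comparable y (⊥⊈y , _) = ⊥⊈y ⊥⊆

comparison-trichotomy : ∀ (w : Fin m → Subset n) y →
  (∃ λ e → Incomparable (w e) y) ⊎ (∃ λ e → y ⊆ w e) ⊎ (∀ e → w e ⊆ y)
comparison-trichotomy w y with any? (λ e → incomparable? (w e) y) | any? (λ e → y ⊆? w e)
... | yes incomparable | _         = inj₁ incomparable
... | no _             | yes below = inj₂ (inj₁ below)
... | no ¬incomparable | no ¬below = inj₂ (inj₂ above)
  where
  above : ∀ e → w e ⊆ y
  above e with w e ⊆? y
  ... | yes w⊆y = w⊆y
  ... | no w⊈y  = ⊥-elim (¬incomparable (e , w⊈y , λ y⊆w → ¬below (e , y⊆w)))

diagonal : (Fin n → Subset n) → Subset n
diagonal w = tabulate (λ e → lookup (w e) e)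

∈-diagonal⁺ : ∀ (w : Fin n → Subset n) {e} → e ∈ w e → e ∈ diagonal w
∈-diagonal⁺ w {e} e∈w = lookup⇒[]= e (diagonal w) (trans (lookup∘tabulate _ e) ([]=⇒lookup e∈w))

∈-diagonal⁻ : ∀ (w : Fin n → Subset n) {e} → e ∈ diagonal w → e ∈ w e
∈-diagonal⁻ w {e} e∈d = lookup⇒[]= e (w e) (trans (sym (lookup∘tabulate _ e)) ([]=⇒lookup e∈d))

comparison-bound : {Y : Pred (Subset n) 0ℓ} (Y? : Decidable Y) (w : Fin n → Subset n) {D h : ℕ} →
  (∀ e → count (Y? ∩? incomparable? (w e)) ≤ D) → (∀ e → ∣ w e ∣ ≤ h) →
  count Y? ≤ n * D + (n * 2 ^ h + 2 ^ ∣ ∁ (diagonal w) ∣)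
comparison-bound {n} {Y} Y? w {D} {h} sparse small = begin
  count Y?
    ≤⟨ count-⊎ Y? Incomparable? (Below? ∪? Above?) cover ⟩
  count Incomparable? + count (Below? ∪? Above?)
    ≤⟨ +-mono-≤ (count-∃ Incomparable? (λ e → Y? ∩? incomparable? (w e)) id sparse)
                (count-⊎ (Below? ∪? Above?) Below? Above? id) ⟩
  n * D + (count Below? + count Above?)
    ≤⟨ +-monoʳ-≤ (n * D) (+-mono-≤ (count-∃ Below? (λ e → _⊆? w e) id below)
                                   (≤-reflexive (count-⊇≡2^∣∁p∣ (diagonal w)))) ⟩
  n * D + (n * 2 ^ h + 2 ^ ∣ ∁ (diagonal w) ∣) ∎
  where
  open ≤-Reasoning
  Incomparable? : Decidable (λ y → ∃ λ e → Y y × Incomparable (w e) y)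
  Incomparable? y = any? (λ e → Y? y ×-dec incomparable? (w e) y)
  Below? : Decidable (λ y → ∃ λ e → y ⊆ w e)
  Below? y = any? (λ e → y ⊆? w e)
  Above? : Decidable (diagonal w ⊆_)
  Above? = diagonal w ⊆?_
  cover : ∀ {y} → Y y → (∃ λ e → Y y × Incomparable (w e) y) ⊎ (∃ λ e → y ⊆ w e) ⊎ diagonal w ⊆ y
  cover {y} Yy with comparison-trichotomy w y
  ... | inj₁ (e , incomparable) = inj₁ (e , Yy , incomparable)
  ... | inj₂ (inj₁ below)       = inj₂ (inj₁ below)
  ... | inj₂ (inj₂ above)       = inj₂ (inj₂ (λ e∈d → above _ (∈-diagonal⁻ w e∈d)))
  below : ∀ e → count (_⊆? w e) ≤ 2 ^ h
  below e = ≤-trans (≤-reflexive (count-⊆≡2^∣p∣ (w e))) (^-monoʳ-≤ 2 (small e))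

module _ {X : Pred (Subset n) 0ℓ} (X? : Decidable X) where

  memberContaining : Fin n → Subset n
  memberContaining e with anySubset? (λ x → X? x ×-dec e ∈? x)
  ... | yes (x , _) = x
  ... | no _        = ⊥

  memberContaining-∈ : ∀ {x e} → X x → e ∈ x → e ∈ memberContaining e
  memberContaining-∈ {x} {e} Xx e∈x with anySubset? (λ x → X? x ×-dec e ∈? x)
  ... | yes (_ , _ , e∈w) = e∈w
  ... | no none           = contradiction (x , Xx , e∈x) none

  memberContaining-X⊎⊥ : ∀ e → X (memberContaining e) ⊎ memberContaining e ≡ ⊥
  memberContaining-X⊎⊥ e with anySubset? (λ x → X? x ×-dec e ∈? x)
  ... | yes (_ , Xw , _) = inj₁ Xw
  ... | no _             = inj₂ refl

  union : Subset n
  union = diagonal memberContaining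

  ⊆-union : ∀ {x} → X x → x ⊆ union
  ⊆-union Xx e∈x = ∈-diagonal⁺ memberContaining (memberContaining-∈ Xx e∈x)

-- Sparsely incomparable pairs of families

dichotomy≤ : ∀ (h D : ℕ) {X Y : Pred (Subset n) 0ℓ} (X? : Decidable X) (Y? : Decidable Y) →
  (∀ {x} → X x → ∣ x ∣ ≤ h) → (∀ {x} → X x → count (Y? ∩? incomparable? x) ≤ D) →
  count X? ≤ 2 ^ h ⊎ count Y? ≤ n * D + (n * 2 ^ h + 2 ^ (n ∸ suc h))
dichotomy≤ {n} h D X? Y? small sparse with ∣ union X? ∣ ≤? h
... | yes ∣U∣≤h = inj₁ (begin
  count X?              ≤⟨ count-mono X? (_⊆? union X?) (⊆-union X?) ⟩
  count (_⊆? union X?)  ≡⟨ count-⊆≡2^∣p∣ (union X?) ⟩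
  2 ^ ∣ union X? ∣      ≤⟨ ^-monoʳ-≤ 2 ∣U∣≤h ⟩
  2 ^ h                 ∎)
  where open ≤-Reasoning
... | no ∣U∣≰h = inj₂ (≤-trans (comparison-bound Y? w sparse-w small-w)
                              (+-monoʳ-≤ (n * D) (+-monoʳ-≤ (n * 2 ^ h) (^-monoʳ-≤ 2 ∣∁U∣≤))))
  where
  w : Fin n → Subset n
  w = memberContaining X?
  sparse-w : ∀ e → count (Y? ∩? incomparable? (w e)) ≤ D
  sparse-w e with memberContaining-X⊎⊥ X? e
  ... | inj₁ Xw  = sparse Xw
  ... | inj₂ w≡⊥ = ≤-trans (≤-reflexive (count-empty (Y? ∩? incomparable? (w e)) λ y (_ , incomparable) →
                     ⊥-comparable y (subst (λ z → Incomparable z y) w≡⊥ incomparable))) z≤n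
  small-w : ∀ e → ∣ w e ∣ ≤ h
  small-w e with memberContaining-X⊎⊥ X? e
  ... | inj₁ Xw  = small Xw
  ... | inj₂ w≡⊥ = ≤-trans (≤-reflexive (trans (cong ∣_∣ w≡⊥) (∣⊥∣≡0 n))) z≤n
  ∣∁U∣≤ : ∣ ∁ (union X?) ∣ ≤ n ∸ suc h
  ∣∁U∣≤ = ≤-trans (≤-reflexive (∣∁p∣≡n∸∣p∣ (union X?))) (∸-monoʳ-≤ n (≰⇒> ∣U∣≰h))

dichotomy≥ : ∀ (h D : ℕ) {X Y : Pred (Subset n) 0ℓ} (X? : Decidable X) (Y? : Decidable Y) →
  (∀ {x} → X x → n ∸ h ≤ ∣ x ∣) → (∀ {x} → X x → count (Y? ∩? incomparable? x) ≤ D) →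
  count X? ≤ 2 ^ h ⊎ count Y? ≤ n * D + (n * 2 ^ h + 2 ^ (n ∸ suc h))
dichotomy≥ {n} h D {X} {Y} X? Y? large sparse =
  Sum.map (≤-trans (≤-reflexive (sym (count-∘-∁ X?)))) (≤-trans (≤-reflexive (sym (count-∘-∁ Y?))))
          (dichotomy≤ h D (X? ∘ ∁) (Y? ∘ ∁) small sparse∁)
  where
  small : ∀ {x} → X (∁ x) → ∣ x ∣ ≤ h
  small {x} X∁x = ∸-cancelʳ-≤ (∣p∣≤n x) (subst (n ∸ h ≤_) (∣∁p∣≡n∸∣p∣ x) (large X∁x))
  sparse∁ : ∀ {x} → X (∁ x) → count ((Y? ∘ ∁) ∩? incomparable? x) ≤ D
  sparse∁ {x} X∁x = begin
    count ((Y? ∘ ∁) ∩? incomparable? x)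
      ≤⟨ count-mono ((Y? ∘ ∁) ∩? incomparable? x) ((Y? ∩? incomparable? (∁ x)) ∘ ∁)
                    (Product.map₂ ∁-incomparable) ⟩
    count ((Y? ∩? incomparable? (∁ x)) ∘ ∁)
      ≡⟨ count-∘-∁ (Y? ∩? incomparable? (∁ x)) ⟩
    count (Y? ∩? incomparable? (∁ x))
      ≤⟨ sparse X∁x ⟩
    D ∎
    where open ≤-Reasoning

dichotomy : ∀ (h D : ℕ) {X Y : Pred (Subset n) 0ℓ} (X? : Decidable X) (Y? : Decidable Y) →
  n ≤ suc (h + h) → (∀ {x} → X x → count (Y? ∩? incomparable? x) ≤ D) →
  count X? ≤ 2 ^ suc h ⊎ count Y? ≤ n * D + suc n * 2 ^ h
dichotomy {n} h D {X} {Y} X? Y? n≤1+2h sparse =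
  combine (dichotomy≤ h D (X? ∩? Small?) Y? proj₂ (sparse ∘ proj₁))
          (dichotomy≥ h D (X? ∩? ∁? Small?) Y? (λ {x} → large {x} ∘ proj₂) (sparse ∘ proj₁))
  where
  open ≤-Reasoning
  Small? : Decidable (λ (x : Subset n) → ∣ x ∣ ≤ h)
  Small? x = ∣ x ∣ ≤? h
  large : ∀ {x : Subset n} → ¬ ∣ x ∣ ≤ h → n ∸ h ≤ ∣ x ∣
  large ≰h = ≤-trans (m≤n+o⇒m∸n≤o n h (subst (n ≤_) (sym (+-suc h h)) n≤1+2h)) (≰⇒> ≰h)
  split : ∀ {x} → X x → (X x × ∣ x ∣ ≤ h) ⊎ (X x × ¬ ∣ x ∣ ≤ h)
  split {x} Xx with ∣ x ∣ ≤? h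
  ... | yes ≤h = inj₁ (Xx , ≤h)
  ... | no ≰h  = inj₂ (Xx , ≰h)
  Ybound : ℕ
  Ybound = n * D + (n * 2 ^ h + 2 ^ (n ∸ suc h))
  weaken : Ybound ≤ n * D + suc n * 2 ^ h
  weaken = +-monoʳ-≤ (n * D) (begin
    n * 2 ^ h + 2 ^ (n ∸ suc h)  ≤⟨ +-monoʳ-≤ (n * 2 ^ h) (^-monoʳ-≤ 2 (m≤n+o⇒m∸n≤o n (suc h) n≤1+2h)) ⟩
    n * 2 ^ h + 2 ^ h            ≡⟨ +-comm (n * 2 ^ h) (2 ^ h) ⟩
    suc n * 2 ^ h                ∎)
  combine : count (X? ∩? Small?) ≤ 2 ^ h ⊎ count Y? ≤ Ybound →
            count (X? ∩? ∁? Small?) ≤ 2 ^ h ⊎ count Y? ≤ Ybound →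
            count X? ≤ 2 ^ suc h ⊎ count Y? ≤ n * D + suc n * 2 ^ h
  combine (inj₂ Y≤)      _             = inj₂ (≤-trans Y≤ weaken)
  combine (inj₁ _)       (inj₂ Y≤)     = inj₂ (≤-trans Y≤ weaken)
  combine (inj₁ fewSmall) (inj₁ fewLarge) = inj₁ (begin
    count X?                                        ≤⟨ count-⊎ X? (X? ∩? Small?) (X? ∩? ∁? Small?) split ⟩
    count (X? ∩? Small?) + count (X? ∩? ∁? Small?)  ≤⟨ +-mono-≤ fewSmall fewLarge ⟩
    2 ^ h + 2 ^ h                                   ≡⟨ cong (2 ^ h +_) (+-identityʳ (2 ^ h)) ⟨
    2 ^ suc h                                       ∎)

colourClass? : (c : PartialColoring n k) (i : Fin k) → Decidable (λ S → c S ≡ just i)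
colourClass? c i S = ≡-dec Finₚ._≟_ (c S) (just i)

classSize≡count : (c : PartialColoring n k) (i : Fin k) → classSize c i ≡ count (colourClass? c i)
classSize≡count c i = length-filter-allSubsets (colourClass? c i)

linkColoring : PartialColoring n (suc k) → Subset n → PartialColoring n k
linkColoring c x y with incomparable? x y | c y
... | yes _ | just (suc i) = just i
... | _     | _            = nothing

linkColoring-≡just⁻ : ∀ (c : PartialColoring n (suc k)) x y {i} →
  linkColoring c x y ≡ just i → Incomparable x y × c y ≡ just (suc i)
linkColoring-≡just⁻ c x y eq with incomparable? x y | c y
linkColoring-≡just⁻ c x y refl | yes incomparable | just (suc i) = incomparable , refl
linkColoring-≡just⁻ c x y ()   | yes _            | just zero
linkColoring-≡just⁻ c x y ()   | yes _            | nothing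
linkColoring-≡just⁻ c x y ()   | no _             | _

linkColoring-≡just⁺ : ∀ (c : PartialColoring n (suc k)) x y {i} →
  Incomparable x y → c y ≡ just (suc i) → linkColoring c x y ≡ just i
linkColoring-≡just⁺ c x y incomparable cy with incomparable? x y | c y
linkColoring-≡just⁺ c x y incomparable refl | yes _            | just (suc _) = refl
linkColoring-≡just⁺ c x y incomparable cy   | no ¬incomparable | _            =
  contradiction incomparable ¬incomparable

◂-isAntichain : ∀ {s} {x : Subset n} {A : Fin s → Subset n} →
  (∀ i → Incomparable x (A i)) → IsAntichain A → IsAntichain (x ◂ A)
◂-isAntichain incomparable antichain zero    zero    0≢0 = contradiction refl 0≢0
◂-isAntichain incomparable antichain zero    (suc j) _   = proj₁ (incomparable j)
◂-isAntichain incomparable antichain (suc i) zero    _   = proj₂ (incomparable i)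
◂-isAntichain incomparable antichain (suc i) (suc j) i≢j = antichain i j (i≢j ∘ cong suc)

linkColoring-noRainbow : ∀ {c : PartialColoring n (suc k)} {x} →
  c x ≡ just zero → NoRainbowAntichain c → NoRainbowAntichain (linkColoring c x)
linkColoring-noRainbow {c = c} {x} cx≡0 noRainbow A antichain (col , coloured , distinct) =
  noRainbow (x ◂ A) (◂-isAntichain (proj₁ ∘ inA) antichain) (zero ◂ (suc ∘ col) , coloured′ , distinct′)
  where
  inA : ∀ i → Incomparable x (A i) × c (A i) ≡ just (suc (col i))
  inA i = linkColoring-≡just⁻ c x (A i) (coloured i)
  coloured′ : ∀ i → c ((x ◂ A) i) ≡ just ((zero ◂ (suc ∘ col)) i)
  coloured′ zero    = cx≡0
  coloured′ (suc i) = proj₂ (inA i)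
  distinct′ : ∀ i j → i ≢ j → (zero ◂ (suc ∘ col)) i ≢ (zero ◂ (suc ∘ col)) j
  distinct′ zero    zero    0≢0 = contradiction refl 0≢0
  distinct′ zero    (suc j) _   = λ ()
  distinct′ (suc i) zero    _   = λ ()
  distinct′ (suc i) (suc j) i≢j = distinct i j (i≢j ∘ cong suc) ∘ Finₚ.suc-injective

count-incomparable≤classSize-linkColoring : ∀ (c : PartialColoring n (suc k)) x i →
  count (colourClass? c (suc i) ∩? incomparable? x) ≤ classSize (linkColoring c x) i
count-incomparable≤classSize-linkColoring c x i = begin
  count (colourClass? c (suc i) ∩? incomparable? x)
    ≤⟨ count-mono (colourClass? c (suc i) ∩? incomparable? x) (colourClass? (linkColoring c x) i)
                  (λ {y} (cy , incomparable) → linkColoring-≡just⁺ c x y incomparable cy) ⟩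
  count (colourClass? (linkColoring c x) i)
    ≡⟨ classSize≡count (linkColoring c x) i ⟨
  classSize (linkColoring c x) i ∎
  where open ≤-Reasoning

-- The bound on the smallest colour class

n≤1+2⌊n/2⌋ : ∀ n → n ≤ suc (⌊ n /2⌋ + ⌊ n /2⌋)
n≤1+2⌊n/2⌋ zero          = z≤n
n≤1+2⌊n/2⌋ (suc zero)    = s≤s z≤n
n≤1+2⌊n/2⌋ (suc (suc n)) =
  s≤s (s≤s (≤-trans (n≤1+2⌊n/2⌋ n) (≤-reflexive (sym (+-suc ⌊ n /2⌋ ⌊ n /2⌋)))))

2⌊n/2⌋≤n : ∀ n → ⌊ n /2⌋ + ⌊ n /2⌋ ≤ n
2⌊n/2⌋≤n zero          = z≤n
2⌊n/2⌋≤n (suc zero)    = z≤n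
2⌊n/2⌋≤n (suc (suc n)) = s≤s (≤-trans (≤-reflexive (+-suc ⌊ n /2⌋ ⌊ n /2⌋)) (s≤s (2⌊n/2⌋≤n n)))

2[1+k]≤3^[1+k] : ∀ k → 2 * suc k ≤ 3 ^ suc k
2[1+k]≤3^[1+k] zero    = s≤s (s≤s z≤n)
2[1+k]≤3^[1+k] (suc k) = begin
  2 * suc (suc k)            ≡⟨ *-suc 2 (suc k) ⟩
  2 + 2 * suc k              ≤⟨ +-mono-≤ (*-monoʳ-≤ 2 (m^n>0 3 (suc k))) (2[1+k]≤3^[1+k] k) ⟩
  2 * 3 ^ suc k + 3 ^ suc k  ≡⟨ +-comm (2 * 3 ^ suc k) _ ⟩
  3 ^ suc (suc k)            ∎
  where open ≤-Reasoning

na+[1+n]≤[3+2n]a : ∀ n a → 1 ≤ a → n * a + suc n ≤ (3 + 2 * n) * a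
na+[1+n]≤[3+2n]a n a 1≤a = begin
  n * a + suc n        ≤⟨ +-monoʳ-≤ (n * a) (≤-trans (m≤n+m (suc n) 2) (m≤m*n (3 + n) a {{a≢0}})) ⟩
  n * a + (3 + n) * a  ≡⟨ regroup n a ⟩
  (3 + 2 * n) * a      ∎
  where
  open ≤-Reasoning
  a≢0 : NonZero a
  a≢0 = >-nonZero 1≤a
  regroup : ∀ n a → n * a + (3 + n) * a ≡ (3 + 2 * n) * a
  regroup = solve-∀

-- In units of 2^⌊n/2⌋, B k := (3 + 2n)^k satisfies n B k + n + 1 ≤ B (k + 1) and
-- 2 (k + 1) ≤ B (k + 1), the two bounds produced by the induction step below.
classBound : ℕ → ℕ → ℕ
classBound n k = (3 + 2 * n) ^ k * 2 ^ ⌊ n /2⌋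

someClass≤classBound : ∀ k (c : PartialColoring n (suc k)) → NoRainbowAntichain c →
  ∃ λ i → classSize c i ≤ classBound n k
someClass≤classBound zero c noRainbow =
  zero , ≤-trans (≤-reflexive (trans (classSize≡count c zero) (count-empty (colourClass? c zero) uncoloured))) z≤n
  where
  uncoloured : ∀ S → ¬ c S ≡ just zero
  uncoloured S cS≡0 =
    noRainbow (λ _ → S) (λ { zero zero 0≢0 → contradiction refl 0≢0 })
              ((λ _ → zero) , (λ { zero → cS≡0 }) , λ { zero zero 0≢0 → contradiction refl 0≢0 })
someClass≤classBound {n} (suc k) c noRainbow = conclude (any? (λ i → count (Y? i) ≤? Ybound))
  where
  open ≤-Reasoning
  h : ℕ
  h = ⌊ n /2⌋
  D : ℕ
  D = classBound n k
  Ybound : ℕ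
  Ybound = n * D + suc n * 2 ^ h
  X? : Decidable (λ S → c S ≡ just zero)
  X? = colourClass? c zero
  Y? : ∀ i → Decidable (λ S → c S ≡ just (suc i))
  Y? i = colourClass? c (suc i)
  Sparse? : ∀ i → Decidable (λ x → count (Y? i ∩? incomparable? x) ≤ D)
  Sparse? i x = count (Y? i ∩? incomparable? x) ≤? D
  sparseFor : ∀ {x} → c x ≡ just zero → ∃ λ i → c x ≡ just zero × count (Y? i ∩? incomparable? x) ≤ D
  sparseFor {x} cx≡0 with someClass≤classBound k (linkColoring c x) (linkColoring-noRainbow cx≡0 noRainbow)
  ... | i , bound = i , cx≡0 , ≤-trans (count-incomparable≤classSize-linkColoring c x i) bound
  conclude : Dec (∃ λ i → count (Y? i) ≤ Ybound) → ∃ λ i → classSize c i ≤ classBound n (suc k)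
  conclude (yes (i , Yi≤)) = suc i , (begin
    classSize c (suc i)                      ≡⟨ classSize≡count c (suc i) ⟩
    count (Y? i)                             ≤⟨ Yi≤ ⟩
    n * (a * 2 ^ h) + suc n * 2 ^ h          ≡⟨ factor n a (2 ^ h) ⟩
    (n * a + suc n) * 2 ^ h                  ≤⟨ *-monoˡ-≤ (2 ^ h) (na+[1+n]≤[3+2n]a n a (m^n>0 (3 + 2 * n) k)) ⟩
    classBound n (suc k)                     ∎)
    where
    a : ℕ
    a = (3 + 2 * n) ^ k
    factor : ∀ n a w → n * (a * w) + suc n * w ≡ (n * a + suc n) * w
    factor = solve-∀
  conclude (no ¬Yi≤) = zero , (begin
    classSize c zero    ≡⟨ classSize≡count c zero ⟩
    count X?            ≤⟨ count-∃ X? (λ i → X? ∩? Sparse? i) sparseFor Xi≤ ⟩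
    suc k * 2 ^ suc h   ≡⟨ regroup (suc k) (2 ^ h) ⟩
    2 * suc k * 2 ^ h   ≤⟨ *-monoˡ-≤ (2 ^ h) (≤-trans (2[1+k]≤3^[1+k] k) (^-monoˡ-≤ (suc k) 3≤3+2n)) ⟩
    classBound n (suc k) ∎)
    where
    Xi≤ : ∀ i → count (X? ∩? Sparse? i) ≤ 2 ^ suc h
    Xi≤ i = Sum.[ id , (λ Yi≤ → contradiction (i , Yi≤) ¬Yi≤) ]′
              (dichotomy h D (X? ∩? Sparse? i) (Y? i) (n≤1+2⌊n/2⌋ n) proj₂)
    3≤3+2n : 3 ≤ 3 + 2 * n
    3≤3+2n = m≤m+n 3 (2 * n)
    regroup : ∀ k w → k * (2 * w) ≡ 2 * k * w
    regroup = solve-∀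

-- From the class bound to the encoded estimate

3+2n≤n^2 : ∀ {n} → 3 ≤ n → 3 + 2 * n ≤ n ^ 2
3+2n≤n^2 {n} 3≤n = begin
  3 + 2 * n  ≤⟨ +-monoˡ-≤ (2 * n) 3≤n ⟩
  n + 2 * n  ≡⟨ regroup n ⟩
  3 * n      ≤⟨ *-monoˡ-≤ n 3≤n ⟩
  n * n      ≡⟨ cong (n *_) (*-identityʳ n) ⟨
  n ^ 2      ∎
  where
  open ≤-Reasoning
  regroup : ∀ n → n + 2 * n ≡ 3 * n
  regroup = solve-∀

-- The ring solver does not see through _^_, so squares are written out as m * (m * 1).
classBound²≤ : ∀ {n} j → 3 ≤ n → classBound n j ^ 2 ≤ n ^ (4 * j) * 2 ^ n
classBound²≤ {n} j 3≤n = begin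
  (a * 2 ^ h) ^ 2                     ≡⟨ square-* a (2 ^ h) ⟩
  a * a * (2 ^ h * 2 ^ h)             ≡⟨ cong (a * a *_) (^-distribˡ-+-* 2 h h) ⟨
  a * a * 2 ^ (h + h)                 ≤⟨ *-mono-≤ (*-mono-≤ a≤ a≤) (^-monoʳ-≤ 2 (2⌊n/2⌋≤n n)) ⟩
  n ^ (2 * j) * n ^ (2 * j) * 2 ^ n   ≡⟨ cong (_* 2 ^ n) (^-distribˡ-+-* n (2 * j) (2 * j)) ⟨
  n ^ (2 * j + 2 * j) * 2 ^ n         ≡⟨ cong (λ e → n ^ e * 2 ^ n) (double j) ⟩
  n ^ (4 * j) * 2 ^ n                 ∎
  where
  open ≤-Reasoning
  h : ℕ
  h = ⌊ n /2⌋
  a : ℕ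
  a = (3 + 2 * n) ^ j
  a≤ : a ≤ n ^ (2 * j)
  a≤ = ≤-trans (^-monoˡ-≤ j (3+2n≤n^2 3≤n)) (≤-reflexive (^-*-assoc n 2 j))
  square-* : ∀ a w → a * w * (a * w * 1) ≡ a * a * (w * w)
  square-* = solve-∀
  double : ∀ j → 2 * j + 2 * j ≡ 4 * j
  double = solve-∀

^-distribʳ-* : ∀ a b q → (a * b) ^ q ≡ a ^ q * b ^ q
^-distribʳ-* a b zero    = refl
^-distribʳ-* a b (suc q) = trans (cong (a * b *_) (^-distribʳ-* a b q)) (regroup a b (a ^ q) (b ^ q))
  where
  regroup : ∀ a b x y → a * b * (x * y) ≡ a * x * (b * y)
  regroup = solve-∀

4jq<p : ∀ {n j p q} → j * j ≤ n → 16 * n * q ^ 2 < p ^ 2 → 4 * j * q < p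
4jq<p {n} {j} {p} {q} j²≤n 16nq²<p² = ≰⇒> λ p≤4jq → <⇒≱ 16nq²<p² (begin
  p ^ 2                 ≤⟨ ^-monoˡ-≤ 2 p≤4jq ⟩
  (4 * j * q) ^ 2       ≡⟨ square-* j q ⟩
  16 * (j * j) * q ^ 2  ≤⟨ *-monoˡ-≤ (q ^ 2) (*-monoʳ-≤ 16 j²≤n) ⟩
  16 * n * q ^ 2        ∎)
  where
  open ≤-Reasoning
  square-* : ∀ j q → 4 * j * q * (4 * j * q * 1) ≡ 16 * (j * j) * (q * (q * 1))
  square-* = solve-∀

boundedBy : ∀ {n k m} j → 1 ≤ k → 2 ≤ n → j * j ≤ n → m ^ 2 ≤ n ^ (4 * j) * 2 ^ n → BoundedBy n k m
boundedBy {n} {k} {m} j 1≤k 2≤n j²≤n m²≤ p q _ 16nq²<p² = begin-strict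
  (m ^ 2) ^ q                      ≤⟨ ^-monoˡ-≤ q m²≤ ⟩
  (n ^ (4 * j) * 2 ^ n) ^ q        ≡⟨ ^-distribʳ-* (n ^ (4 * j)) (2 ^ n) q ⟩
  (n ^ (4 * j)) ^ q * (2 ^ n) ^ q  ≡⟨ cong (_* (2 ^ n) ^ q) (^-*-assoc n (4 * j) q) ⟩
  n ^ (4 * j * q) * (2 ^ n) ^ q    <⟨ *-monoˡ-< ((2 ^ n) ^ q) {{m^n≢0 (2 ^ n) q {{m^n≢0 2 n}}}}
                                                (^-monoʳ-< n 2≤n (4jq<p {n} {j} {p} {q} j²≤n 16nq²<p²)) ⟩
  n ^ p * (2 ^ n) ^ q              ≤⟨ *-monoʳ-≤ (n ^ p) (^-monoˡ-≤ q (m≤n*m (2 ^ n) (k ^ 2) {{k²≢0}})) ⟩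
  n ^ p * (k ^ 2 * 2 ^ n) ^ q      ∎
  where
  open ≤-Reasoning
  k²≢0 : NonZero (k ^ 2)
  k²≢0 = m^n≢0 k 2 {{>-nonZero 1≤k}}

F≤f : ∀ {n k F f} → IsF n k F → Isf n k f → F ≤ f
F≤f ((c , noRainbow , large) , _) (_ , maximal) = maximal _ (total c , noRainbow , large)

achievable≤classBound : ∀ {n k m} → AchievablePartial n (suc k) m → m ≤ classBound n k
achievable≤classBound {k = k} (c , noRainbow , large) with someClass≤classBound k c noRainbow
... | i , small = ≤-trans (large i) small

theorem2 : ∀ (k : ℕ) → 2 ≤ k → Σ ℕ λ n₀ → ∀ (n : ℕ) → n₀ ≤ n → ∀ (F f : ℕ) → IsF n k F → Isf n k f → (F ≤ f) × BoundedBy n k f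
theorem2 zero ()
theorem2 (suc j) _ = 3 + j * j , bounds
  where
  bounds : ∀ n → 3 + j * j ≤ n → ∀ F f →
           IsF n (suc j) F → Isf n (suc j) f → (F ≤ f) × BoundedBy n (suc j) f
  bounds n n₀≤n F f isF isf = F≤f isF isf , boundedBy {n} {suc j} {f} j (s≤s z≤n) 2≤n j²≤n f²≤
    where
    2≤n : 2 ≤ n
    2≤n = ≤-trans (m≤m+n 2 (suc (j * j))) n₀≤n
    j²≤n : j * j ≤ n
    j²≤n = ≤-trans (m≤n+m (j * j) 3) n₀≤n
    f²≤ : f ^ 2 ≤ n ^ (4 * j) * 2 ^ n
    f²≤ = ≤-trans (^-monoˡ-≤ 2 (achievable≤classBound (proj₁ isf)))
                  (classBound²≤ j (≤-trans (m≤m+n 3 (j * j)) n₀≤n))
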